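{- Let $k \geq 1$ and $n \geq 1$, and let $P_n^k$ be the $k$-th power of a path on $n$ vertices. Then: if $n \leq k+1$, every biclique of $P_n^k$ induces $P_2$ (i.e. has exactly two vertices); if $k+2 \leq n \leq 2k$, every biclique of $P_n^k$ induces either $P_2$ or $P_3$, and bicliques of both kinds exist; if $n \geq 2k+1$, every biclique of $P_n^k$ induces $P_3$.
   Context: For $k \geq 1$, the power of a path $P_n^k$ is the simple graph with vertex set $\{v_0,\dots,v_{n-1}\}$ in which $v_i v_j$ is an edge if and only if $0<|i-j| \leq k$. A biclique of a graph is a maximal (under inclusion) set of vertices inducing a complete bipartite subgraph with at least one edge. $P_2$ and $P_3$ denote the paths on 2 and 3 vertices. -}

module Defs where

open import Data.Nat using (ℕ; _≤_; _<_; ∣_-_∣)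
open import Data.Fin using (Fin; toℕ)
open import Data.Fin.Subset using (Subset; _∈_; _∉_; _⊆_)
open import Data.Product using (Σ; _×_; ∃; ∃-syntax)
open import Data.Sum using (_⊎_)
open import Relation.Nullary using (¬_)
open import Relation.Binary.PropositionalEquality using (_≡_; _≢_)
open import Function.Bundles using (_⇔_)

Adj : {n : ℕ} → ℕ → Fin n → Fin n → Set
Adj k i j = (0 < ∣ toℕ i - toℕ j ∣) × (∣ toℕ i - toℕ j ∣ ≤ k)

IsCompleteBipartite : {n : ℕ} → ℕ → Subset n → Set
IsCompleteBipartite {n} k S =
  Σ (Subset n) λ A → Σ (Subset n) λ B →
    (∀ v → v ∈ S ⇔ (v ∈ A ⊎ v ∈ B)) ×
    (∀ v → v ∈ A → v ∉ B) ×
    (∃[ a ] a ∈ A) × (∃[ b ] b ∈ B) ×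
    (∀ a b → a ∈ A → b ∈ B → Adj k a b) ×
    (∀ a a′ → a ∈ A → a′ ∈ A → ¬ Adj k a a′) ×
    (∀ b b′ → b ∈ B → b′ ∈ B → ¬ Adj k b b′)

IsBiclique : {n : ℕ} → ℕ → Subset n → Set
IsBiclique {n} k S =
  IsCompleteBipartite k S × (∀ (T : Subset n) → S ⊆ T → IsCompleteBipartite k T → T ⊆ S)

InducesP2 : {n : ℕ} → ℕ → Subset n → Set
InducesP2 {n} k S =
  Σ (Fin n) λ x → Σ (Fin n) λ y →
    x ≢ y × Adj k x y × (∀ v → v ∈ S ⇔ (v ≡ x ⊎ v ≡ y))

InducesP3 : {n : ℕ} → ℕ → Subset n → Set
InducesP3 {n} k S =
  Σ (Fin n) λ x → Σ (Fin n) λ y → Σ (Fin n) λ z →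
    x ≢ y × y ≢ z × x ≢ z ×
    Adj k x y × Adj k y z × ¬ Adj k x z ×
    (∀ v → v ∈ S ⇔ (v ≡ x ⊎ v ≡ y ⊎ v ≡ z))

-- P_n^k is a proper interval graph, so it has no induced C₄ (two common neighbours of
-- vertices more than k apart are within k of each other) and no induced claw (of three
-- neighbours of a vertex, two lie on the same side of it). Hence in a complete bipartite
-- set one side is a single vertex and the other has at most two, so it induces P₂ or P₃,
-- and every induced P₃ is already maximal. An edge {x, y} is a biclique exactly when no
-- third vertex is adjacent to one of x, y but not the other. For n ≤ k + 1 the graph is
-- complete, so nothing induces P₃; for n ≥ 2k + 1 every edge is separated by
-- v₍ₓ₊ₖ₊₁₎ or v₍ᵧ₋ₖ₋₁₎; in between, v₀ v₁ v₍ₖ₊₁₎ is an induced P₃ and the two vertices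
-- v₍ₙ₋ₖ₋₁₎ and vₖ, adjacent to everything, form a P₂ biclique.

module Submission where

open import Data.Empty using (⊥; ⊥-elim)
open import Data.Fin using (Fin; toℕ; fromℕ<)
open import Data.Fin.Properties using (toℕ-injective; toℕ-fromℕ<; toℕ<n; any?) renaming (_≟_ to _≟ᶠ_)
open import Data.Fin.Subset using (Subset; _∈_; _∉_; _⊆_; ⁅_⁆; _∪_)
open import Data.Fin.Subset.Properties using (x∈⁅x⁆; x∈⁅y⁆⇒x≡y; x∈⁅y⁆⇔x≡y; ∪⇔⊎; _∈?_)
open import Data.Nat
open import Data.Nat.Properties
open import Data.Product using (Σ; ∃; _×_; _,_; proj₁; proj₂; map₂)
open import Data.Sum using (_⊎_; inj₁; inj₂; [_,_]; swap) renaming (map to map⊎)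
open import Data.Sum.Function.Propositional using (_⊎-⇔_)
open import Function using (_∘_; _⇔_; mk⇔; Equivalence)
open import Function.Properties.Equivalence using () renaming (trans to ⇔-trans; sym to ⇔-sym)
open import Relation.Binary.Definitions using (tri<; tri≈; tri>)
open import Relation.Binary.PropositionalEquality using (_≡_; _≢_; refl; sym; trans; cong; subst; ≢-sym)
open import Relation.Nullary using (¬_; yes; no)
open import Relation.Nullary.Decidable using (decidable-stable; _×-dec_; ¬?)

open import Defs

2*k≡k+k : ∀ k → 2 * k ≡ k + k
2*k≡k+k k = cong (k +_) (+-identityʳ k)

-- ∣ m - m′ ∣ ≤ k, stated without truncated subtraction
Near : ℕ → ℕ → ℕ → Set
Near k m m′ = m ≤ m′ + k × m′ ≤ m + k

module _ {k : ℕ} where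

  near-sym : ∀ {m m′} → Near k m m′ → Near k m′ m
  near-sym (p , q) = q , p

  near-refl : ∀ m → Near k m m
  near-refl m = m≤m+n m k , m≤m+n m k

  ¬near⇒≢ : ∀ {m m′} → ¬ Near k m m′ → m ≢ m′
  ¬near⇒≢ {m} ¬near refl = ¬near (near-refl m)

  ∣-∣≤⇒near : ∀ m m′ → ∣ m - m′ ∣ ≤ k → Near k m m′
  ∣-∣≤⇒near m m′ d≤k =
    ≤-trans (m≤n+∣m-n∣ m m′) (+-monoʳ-≤ m′ d≤k) ,
    ≤-trans (m≤n+∣m-n∣ m′ m) (+-monoʳ-≤ m (subst (_≤ k) (∣-∣-comm m m′) d≤k))

  near⇒∣-∣≤ : ∀ m m′ → Near k m m′ → ∣ m - m′ ∣ ≤ k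
  near⇒∣-∣≤ m m′ (m≤ , m′≤) with ≤-total m m′
  ... | inj₁ m≤m′ rewrite m≤n⇒∣m-n∣≡n∸m m≤m′ = m≤n+o⇒m∸n≤o m′ m m′≤
  ... | inj₂ m′≤m rewrite m≤n⇒∣n-m∣≡n∸m m′≤m = m≤n+o⇒m∸n≤o m m′ m≤

  ¬near⇒+< : ∀ {m m′} → m ≤ m′ → ¬ Near k m m′ → m + k < m′
  ¬near⇒+< {m} {m′} m≤m′ ¬near = ≰⇒> λ m′≤ → ¬near (≤-trans m≤m′ (m≤m+n m′ k) , m′≤)

  gap-across : ∀ {c c′ d d′} → c + k < c′ → Near k c d → Near k c′ d′ → d ≤ d′ + k
  gap-across c+k<c′ (_ , d≤) (c′≤ , _) = <⇒≤ (≤-<-trans d≤ (<-≤-trans c+k<c′ c′≤))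

  near-common-≤ : ∀ {a a′ b b′} → a ≤ a′ → ¬ Near k a a′ →
    Near k a b → Near k a′ b → Near k a b′ → Near k a′ b′ → Near k b b′
  near-common-≤ a≤a′ ¬near nab na′b nab′ na′b′ =
    gap-across gap nab na′b′ , gap-across gap nab′ na′b
    where gap = ¬near⇒+< a≤a′ ¬near

  near-common : ∀ {a a′ b b′} → ¬ Near k a a′ →
    Near k a b → Near k a′ b → Near k a b′ → Near k a′ b′ → Near k b b′
  near-common {a} {a′} ¬near nab na′b nab′ na′b′ with ≤-total a a′
  ... | inj₁ a≤a′ = near-common-≤ a≤a′ ¬near nab na′b nab′ na′b′
  ... | inj₂ a′≤a = near-common-≤ a′≤a (¬near ∘ near-sym) na′b nab na′b′ nab′

  near-below : ∀ {a₁ a₂ b} → a₁ ≤ b → a₂ ≤ b → Near k a₁ b → Near k a₂ b → Near k a₁ a₂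
  near-below a₁≤b a₂≤b (_ , b≤a₁+k) (_ , b≤a₂+k) = ≤-trans a₁≤b b≤a₂+k , ≤-trans a₂≤b b≤a₁+k

  near-above : ∀ {a₁ a₂ b} → b ≤ a₁ → b ≤ a₂ → Near k a₁ b → Near k a₂ b → Near k a₁ a₂
  near-above b≤a₁ b≤a₂ (a₁≤b+k , _) (a₂≤b+k , _) =
    ≤-trans a₁≤b+k (+-monoˡ-≤ k b≤a₂) , ≤-trans a₂≤b+k (+-monoˡ-≤ k b≤a₁)

  -- Two of the three points lie on the same side of b.
  near-claw : ∀ {a₁ a₂ a₃ b} → ¬ Near k a₁ a₂ → ¬ Near k a₁ a₃ → ¬ Near k a₂ a₃ →
    Near k a₁ b → Near k a₂ b → Near k a₃ b → ⊥
  near-claw {a₁} {a₂} {a₃} {b} ¬n₁₂ ¬n₁₃ ¬n₂₃ n₁ n₂ n₃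
    with ≤-total a₁ b | ≤-total a₂ b | ≤-total a₃ b
  ... | inj₁ p | inj₁ q | _      = ¬n₁₂ (near-below p q n₁ n₂)
  ... | inj₂ p | inj₂ q | _      = ¬n₁₂ (near-above p q n₁ n₂)
  ... | inj₁ p | inj₂ _ | inj₁ r = ¬n₁₃ (near-below p r n₁ n₃)
  ... | inj₁ _ | inj₂ q | inj₂ r = ¬n₂₃ (near-above q r n₂ n₃)
  ... | inj₂ _ | inj₁ q | inj₁ r = ¬n₂₃ (near-below q r n₂ n₃)
  ... | inj₂ p | inj₁ _ | inj₂ r = ¬n₁₃ (near-above p r n₁ n₃)

  near-every-point : ∀ {n u v} → u ≤ k → n ≤ suc (u + k) → v < n → Near k v u
  near-every-point {v = v} u≤k n≤ v<n = m<1+n⇒m≤n (<-≤-trans v<n n≤) , ≤-trans u≤k (m≤n+m k v)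

  Separates : ℕ → ℕ → ℕ → Set
  Separates z x y = ¬ Near k z x × z ≢ y × Near k z y

  -- Either x + k + 1 is a vertex, or x ≥ k and then y − (k + 1) is one.
  separating-point : ∀ {n x y} → k + k < n → x < y → y ≤ x + k → y < n →
    ∃ λ z → z < n × (Separates z x y ⊎ Separates z y x)
  separating-point {n} {x} {y} 2k<n x<y y≤x+k y<n with suc (x + k) <? n
  ... | yes z<n = suc (x + k) , z<n , inj₁
        ( 1+n≰n ∘ proj₁
        , ≢-sym (<⇒≢ (s≤s y≤x+k))
        , +-monoˡ-≤ k x<y , ≤-trans y≤x+k (≤-trans (n≤1+n _) (m≤m+n _ k)))
  ... | no z≮n = z , <-trans z<x (<-trans x<y y<n) , inj₂
        ( (λ (_ , y≤z+k) → 1+n≰n (subst (_≤ z + k) (sym z+k+1≡y) y≤z+k))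
        , <⇒≢ z<x
        , ≤-trans (<⇒≤ z<x) (m≤m+n x k) , s≤s⁻¹ (subst (x <_) (sym z+k+1≡y) x<y))
    where
    k≤x : k ≤ x
    k≤x = +-cancelʳ-≤ k k x (s≤s⁻¹ (≤-trans 2k<n (≮⇒≥ z≮n)))
    z = y ∸ suc k
    z+k+1≡y : suc (z + k) ≡ y
    z+k+1≡y = trans (sym (+-suc z k)) (m∸n+n≡m (≤-<-trans k≤x x<y))
    z<x : z < x
    z<x = +-cancelʳ-≤ k (suc z) x (subst (_≤ x + k) (sym z+k+1≡y) y≤x+k)

Universal : ∀ {n} → ℕ → Fin n → Set
Universal k u = ∀ v → v ≢ u → Adj k v u

Distinguishes : ∀ {n} → ℕ → Fin n → Fin n → Fin n → Set
Distinguishes k z x y = z ≢ x × ¬ Adj k z x × Adj k z y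

module _ {n k : ℕ} where

  adj⇒near : ∀ (i j : Fin n) → Adj k i j → Near k (toℕ i) (toℕ j)
  adj⇒near i j (_ , d≤k) = ∣-∣≤⇒near (toℕ i) (toℕ j) d≤k

  adj⇒≢ : ∀ (i j : Fin n) → Adj k i j → i ≢ j
  adj⇒≢ i j (0<d , _) refl = <-irrefl (sym (∣n-n∣≡0 (toℕ i))) 0<d

  toℕ-adj : ∀ {i j : Fin n} {m m′} → toℕ i ≡ m → toℕ j ≡ m′ → m ≢ m′ → Near k m m′ → Adj k i j
  toℕ-adj {i} {j} refl refl m≢m′ near =
    n≢0⇒n>0 (m≢m′ ∘ ∣m-n∣≡0⇒m≡n) , near⇒∣-∣≤ (toℕ i) (toℕ j) near

  toℕ-far : ∀ {i j : Fin n} {m m′} → toℕ i ≡ m → toℕ j ≡ m′ → ¬ Near k m m′ → i ≢ j × ¬ Adj k i j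
  toℕ-far {i} {j} refl refl ¬near = ¬near⇒≢ ¬near ∘ cong toℕ , ¬near ∘ adj⇒near i j

  adj-sym : ∀ (i j : Fin n) → Adj k i j → Adj k j i
  adj-sym i j a = toℕ-adj refl refl (≢-sym (adj⇒≢ i j a ∘ toℕ-injective)) (near-sym (adj⇒near i j a))

  ¬adj-refl : ∀ (i : Fin n) → ¬ Adj k i i
  ¬adj-refl i a = adj⇒≢ i i a refl

  ¬adj⇒¬near : ∀ (i j : Fin n) → i ≢ j → ¬ Adj k i j → ¬ Near k (toℕ i) (toℕ j)
  ¬adj⇒¬near i j i≢j ¬a near = ¬a (toℕ-adj refl refl (i≢j ∘ toℕ-injective) near)

  no-induced-C₄ : ∀ (a a′ b b′ : Fin n) → a ≢ a′ → ¬ Adj k a a′ →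
    Adj k a b → Adj k a′ b → Adj k a b′ → Adj k a′ b′ → ¬ Adj k b b′ → b ≡ b′
  no-induced-C₄ a a′ b b′ a≢a′ ¬aa′ ab a′b ab′ a′b′ ¬bb′ =
    decidable-stable (b ≟ᶠ b′) λ b≢b′ → ¬adj⇒¬near b b′ b≢b′ ¬bb′
      (near-common (¬adj⇒¬near a a′ a≢a′ ¬aa′)
        (adj⇒near a b ab) (adj⇒near a′ b a′b) (adj⇒near a b′ ab′) (adj⇒near a′ b′ a′b′))

  no-induced-claw : ∀ (b a₁ a₂ a₃ : Fin n) → a₁ ≢ a₂ → a₁ ≢ a₃ → a₂ ≢ a₃ →
    ¬ Adj k a₁ a₂ → ¬ Adj k a₁ a₃ → ¬ Adj k a₂ a₃ → Adj k a₁ b → Adj k a₂ b → Adj k a₃ b → ⊥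
  no-induced-claw b a₁ a₂ a₃ a₁≢a₂ a₁≢a₃ a₂≢a₃ ¬a₁₂ ¬a₁₃ ¬a₂₃ a₁b a₂b a₃b =
    near-claw (¬adj⇒¬near a₁ a₂ a₁≢a₂ ¬a₁₂) (¬adj⇒¬near a₁ a₃ a₁≢a₃ ¬a₁₃) (¬adj⇒¬near a₂ a₃ a₂≢a₃ ¬a₂₃)
      (adj⇒near a₁ b a₁b) (adj⇒near a₂ b a₂b) (adj⇒near a₃ b a₃b)

  universal : ∀ {u : Fin n} {m} → toℕ u ≡ m → m ≤ k → n ≤ suc (m + k) → Universal k u
  universal refl m≤k n≤ v v≢u =
    toℕ-adj refl refl (v≢u ∘ toℕ-injective) (near-every-point m≤k n≤ (toℕ<n v))

  separates⇒distinguishes : ∀ {z x y : Fin n} {m} → toℕ z ≡ m →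
    Separates m (toℕ x) (toℕ y) → Distinguishes k z x y
  separates⇒distinguishes z≡m (¬near , m≢y , near) =
    map₂ (_, toℕ-adj z≡m refl m≢y near) (toℕ-far z≡m refl ¬near)

  <-adjacent-distinguished : k + k < n → ∀ (x y : Fin n) → toℕ x < toℕ y → toℕ y ≤ toℕ x + k →
    ∃ λ z → Distinguishes k z x y ⊎ Distinguishes k z y x
  <-adjacent-distinguished 2k<n x y x<y y≤x+k with separating-point 2k<n x<y y≤x+k (toℕ<n y)
  ... | m , m<n , sep =
    fromℕ< m<n ,
    map⊎ (separates⇒distinguishes (toℕ-fromℕ< m<n)) (separates⇒distinguishes (toℕ-fromℕ< m<n)) sep

  adjacent-distinguished : k + k < n → ∀ (x y : Fin n) → Adj k x y →
    ∃ λ z → Distinguishes k z x y ⊎ Distinguishes k z y x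
  adjacent-distinguished 2k<n x y a with <-cmp (toℕ x) (toℕ y)
  ... | tri< x<y _ _ = <-adjacent-distinguished 2k<n x y x<y (proj₂ (adj⇒near x y a))
  ... | tri≈ _ x≡y _ = ⊥-elim (adj⇒≢ x y a (toℕ-injective x≡y))
  ... | tri> _ _ y<x = map₂ swap (<-adjacent-distinguished 2k<n y x y<x (proj₁ (adj⇒near x y a)))

IsPair : ∀ {n} → Subset n → Fin n → Fin n → Set
IsPair S x y = ∀ v → v ∈ S ⇔ (v ≡ x ⊎ v ≡ y)

IsTriple : ∀ {n} → Subset n → Fin n → Fin n → Fin n → Set
IsTriple S x y z = ∀ v → v ∈ S ⇔ (v ≡ x ⊎ v ≡ y ⊎ v ≡ z)

module _ {n : ℕ} where

  pair : Fin n → Fin n → Subset n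
  pair x y = ⁅ x ⁆ ∪ ⁅ y ⁆

  triple : Fin n → Fin n → Fin n → Subset n
  triple x y z = ⁅ x ⁆ ∪ pair y z

  pair-isPair : ∀ x y → IsPair (pair x y) x y
  pair-isPair x y v = ⇔-trans (∪⇔⊎ {p = ⁅ x ⁆}) (x∈⁅y⁆⇔x≡y ⊎-⇔ x∈⁅y⁆⇔x≡y)

  triple-isTriple : ∀ x y z → IsTriple (triple x y z) x y z
  triple-isTriple x y z v = ⇔-trans (∪⇔⊎ {p = ⁅ x ⁆}) (x∈⁅y⁆⇔x≡y ⊎-⇔ pair-isPair y z v)

  isPair-sym : ∀ {S : Subset n} {x y} → IsPair S x y → IsPair S y x
  isPair-sym S≐ v =
    mk⇔ (λ v∈S → swap (Equivalence.to (S≐ v) v∈S)) (λ v≡ → Equivalence.from (S≐ v) (swap v≡))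

  sole-or-another : ∀ (A : Subset n) {a} → a ∈ A → (∀ {v} → v ∈ A → v ≡ a) ⊎ ∃ λ a′ → a′ ∈ A × a′ ≢ a
  sole-or-another A {a} a∈A with any? (λ v → (v ∈? A) ×-dec ¬? (v ≟ᶠ a))
  ... | yes another = inj₂ another
  ... | no ¬another = inj₁ λ {v} v∈A → decidable-stable (v ≟ᶠ a) λ v≢a → ¬another (v , v∈A , v≢a)

module _ {n k : ℕ} where

  record Bipartition (S A B : Subset n) : Set where
    field
      split : ∀ {v} → v ∈ S → v ∈ A ⊎ v ∈ B
      A⊆S : A ⊆ S
      B⊆S : B ⊆ S
      disjoint : ∀ {v} → v ∈ A → v ∈ B → ⊥
      complete : ∀ {a b} → a ∈ A → b ∈ B → Adj k a b
      A-independent : ∀ {a a′} → a ∈ A → a′ ∈ A → ¬ Adj k a a′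
      B-independent : ∀ {b b′} → b ∈ B → b′ ∈ B → ¬ Adj k b b′

  bipartition : ∀ {S : Subset n} → IsCompleteBipartite k S →
    Σ (Subset n) λ A → Σ (Subset n) λ B → Bipartition S A B × ∃ (_∈ A) × ∃ (_∈ B)
  bipartition (A , B , S≐A∪B , disjoint , a , b , complete , A-indep , B-indep) =
    A , B , record
      { split = λ {v} → Equivalence.to (S≐A∪B v)
      ; A⊆S = λ {v} → Equivalence.from (S≐A∪B v) ∘ inj₁
      ; B⊆S = λ {v} → Equivalence.from (S≐A∪B v) ∘ inj₂
      ; disjoint = λ {v} → disjoint v
      ; complete = λ {a} {b} → complete a b
      ; A-independent = λ {a} {a′} → A-indep a a′
      ; B-independent = λ {b} {b′} → B-indep b b′
      } , a , b

  flip : ∀ {S A B} → Bipartition S A B → Bipartition S B A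
  flip P = record
    { split = swap ∘ split
    ; A⊆S = B⊆S
    ; B⊆S = A⊆S
    ; disjoint = λ v∈B v∈A → disjoint v∈A v∈B
    ; complete = λ {b} {a} b∈B a∈A → adj-sym a b (complete a∈A b∈B)
    ; A-independent = B-independent
    ; B-independent = A-independent
    }
    where open Bipartition P

  module _ {S A B : Subset n} (P : Bipartition S A B) where
    open Bipartition P

    sides : ∀ {u w} → u ∈ S → w ∈ S → Adj k u w → (u ∈ A × w ∈ B) ⊎ (u ∈ B × w ∈ A)
    sides u∈S w∈S u~w with split u∈S | split w∈S
    ... | inj₁ u∈A | inj₁ w∈A = ⊥-elim (A-independent u∈A w∈A u~w)
    ... | inj₁ u∈A | inj₂ w∈B = inj₁ (u∈A , w∈B)
    ... | inj₂ u∈B | inj₁ w∈A = inj₂ (u∈B , w∈A)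
    ... | inj₂ u∈B | inj₂ w∈B = ⊥-elim (B-independent u∈B w∈B u~w)

    universal-alone : ∀ {u v} → Universal k u → u ∈ A → v ∈ A → v ≡ u
    universal-alone {u} {v} u-univ u∈A v∈A =
      decidable-stable (v ≟ᶠ u) λ v≢u → A-independent v∈A u∈A (u-univ v v≢u)

    opposite-sole : ∀ {a a′ b b′} → a ∈ A → a′ ∈ A → a ≢ a′ → b ∈ B → b′ ∈ B → b ≡ b′
    opposite-sole {a} {a′} {b} {b′} a∈A a′∈A a≢a′ b∈B b′∈B =
      no-induced-C₄ a a′ b b′ a≢a′ (A-independent a∈A a′∈A)
        (complete a∈A b∈B) (complete a′∈A b∈B) (complete a∈A b′∈B) (complete a′∈A b′∈B)
        (B-independent b∈B b′∈B)

    ⊆triple : ∀ {a a′ b} → a ∈ A → a′ ∈ A → a ≢ a′ → b ∈ B →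
      ∀ {v} → v ∈ S → v ≡ a ⊎ v ≡ b ⊎ v ≡ a′
    ⊆triple a∈A a′∈A a≢a′ b∈B v∈S with split v∈S
    ... | inj₂ v∈B = inj₂ (inj₁ (opposite-sole a∈A a′∈A a≢a′ v∈B b∈B))
    ⊆triple {a} {a′} {b} a∈A a′∈A a≢a′ b∈B {v} v∈S | inj₁ v∈A with v ≟ᶠ a | v ≟ᶠ a′
    ... | yes v≡a | _        = inj₁ v≡a
    ... | no _    | yes v≡a′ = inj₂ (inj₂ v≡a′)
    ... | no v≢a  | no v≢a′  = ⊥-elim (no-induced-claw b a a′ v a≢a′ (≢-sym v≢a) (≢-sym v≢a′)
          (A-independent a∈A a′∈A) (A-independent a∈A v∈A) (A-independent a′∈A v∈A)
          (complete a∈A b∈B) (complete a′∈A b∈B) (complete v∈A b∈B))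

    inducesP3 : ∀ {a a′ b} → a ∈ A → a′ ∈ A → a ≢ a′ → b ∈ B → InducesP3 k S
    inducesP3 {a} {a′} {b} a∈A a′∈A a≢a′ b∈B =
      a , b , a′ , (λ a≡b → disjoint a∈A (subst (_∈ B) (sym a≡b) b∈B)) ,
      (λ b≡a′ → disjoint a′∈A (subst (_∈ B) b≡a′ b∈B)) , a≢a′ ,
      complete a∈A b∈B , adj-sym a′ b (complete a′∈A b∈B) , A-independent a∈A a′∈A ,
      λ v → mk⇔ (⊆triple a∈A a′∈A a≢a′ b∈B) λ
        { (inj₁ refl) → A⊆S a∈A ; (inj₂ (inj₁ refl)) → B⊆S b∈B ; (inj₂ (inj₂ refl)) → A⊆S a′∈A }

  classify : ∀ {S : Subset n} → IsCompleteBipartite k S → InducesP2 k S ⊎ InducesP3 k S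
  classify cb with bipartition cb
  ... | A , B , P , (a , a∈A) , (b , b∈B) with sole-or-another A a∈A | sole-or-another B b∈B
  ... | inj₂ (a′ , a′∈A , a′≢a) | _ = inj₂ (inducesP3 P a∈A a′∈A (≢-sym a′≢a) b∈B)
  ... | inj₁ _ | inj₂ (b′ , b′∈B , b′≢b) = inj₂ (inducesP3 (flip P) b∈B b′∈B (≢-sym b′≢b) a∈A)
  ... | inj₁ A≐a | inj₁ B≐b =
    inj₁ (a , b , adj⇒≢ a b (complete a∈A b∈B) , complete a∈A b∈B ,
          λ v → mk⇔ (map⊎ A≐a B≐b ∘ split) λ { (inj₁ refl) → A⊆S a∈A ; (inj₂ refl) → B⊆S b∈B })
    where open Bipartition P

  ⁅⁆-independent : ∀ (u : Fin n) v v′ → v ∈ ⁅ u ⁆ → v′ ∈ ⁅ u ⁆ → ¬ Adj k v v′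
  ⁅⁆-independent u v v′ v∈u v′∈u with x∈⁅y⁆⇒x≡y u v∈u | x∈⁅y⁆⇒x≡y u v′∈u
  ... | refl | refl = ¬adj-refl u

  pair-completeBipartite : ∀ {S : Subset n} {x y} → Adj k x y → IsPair S x y → IsCompleteBipartite k S
  pair-completeBipartite {x = x} {y} x~y S≐ =
    ⁅ x ⁆ , ⁅ y ⁆ , (λ v → ⇔-trans (S≐ v) (⇔-sym (x∈⁅y⁆⇔x≡y ⊎-⇔ x∈⁅y⁆⇔x≡y))) ,
    disjoint , (x , x∈⁅x⁆ x) , (y , x∈⁅x⁆ y) , complete , ⁅⁆-independent x , ⁅⁆-independent y
    where
    disjoint : ∀ v → v ∈ ⁅ x ⁆ → v ∉ ⁅ y ⁆
    disjoint v v∈x v∈y with x∈⁅y⁆⇒x≡y x v∈x | x∈⁅y⁆⇒x≡y y v∈y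
    ... | refl | refl = adj⇒≢ x y x~y refl
    complete : ∀ a b → a ∈ ⁅ x ⁆ → b ∈ ⁅ y ⁆ → Adj k a b
    complete a b a∈x b∈y with x∈⁅y⁆⇒x≡y x a∈x | x∈⁅y⁆⇒x≡y y b∈y
    ... | refl | refl = x~y

  triple-completeBipartite : ∀ {S : Subset n} {x y z} → Adj k x y → Adj k y z → ¬ Adj k x z →
    IsTriple S x y z → IsCompleteBipartite k S
  triple-completeBipartite {S} {x} {y} {z} x~y y~z ¬x~z S≐ =
    pair x z , ⁅ y ⁆ , (λ v → mk⇔ (to v) (from v)) , disjoint ,
    (x , pair∋ (inj₁ refl)) , (y , x∈⁅x⁆ y) , complete , independent , ⁅⁆-independent y
    where
    pair∋ : ∀ {v} → v ≡ x ⊎ v ≡ z → v ∈ pair x z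
    pair∋ {v} = Equivalence.from (pair-isPair x z v)
    pair∈ : ∀ {v} → v ∈ pair x z → v ≡ x ⊎ v ≡ z
    pair∈ {v} = Equivalence.to (pair-isPair x z v)
    to : ∀ v → v ∈ S → v ∈ pair x z ⊎ v ∈ ⁅ y ⁆
    to v v∈S with Equivalence.to (S≐ v) v∈S
    ... | inj₁ v≡x = inj₁ (pair∋ (inj₁ v≡x))
    ... | inj₂ (inj₁ refl) = inj₂ (x∈⁅x⁆ y)
    ... | inj₂ (inj₂ v≡z) = inj₁ (pair∋ (inj₂ v≡z))
    from : ∀ v → v ∈ pair x z ⊎ v ∈ ⁅ y ⁆ → v ∈ S
    from v (inj₁ v∈xz) = Equivalence.from (S≐ v) ([ inj₁ , inj₂ ∘ inj₂ ] (pair∈ v∈xz))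
    from v (inj₂ v∈y) = Equivalence.from (S≐ v) (inj₂ (inj₁ (x∈⁅y⁆⇒x≡y y v∈y)))
    disjoint : ∀ v → v ∈ pair x z → v ∉ ⁅ y ⁆
    disjoint v v∈xz v∈y with pair∈ v∈xz | x∈⁅y⁆⇒x≡y y v∈y
    ... | inj₁ refl | refl = adj⇒≢ x y x~y refl
    ... | inj₂ refl | refl = adj⇒≢ y z y~z refl
    complete : ∀ a b → a ∈ pair x z → b ∈ ⁅ y ⁆ → Adj k a b
    complete a b a∈xz b∈y with pair∈ a∈xz | x∈⁅y⁆⇒x≡y y b∈y
    ... | inj₁ refl | refl = x~y
    ... | inj₂ refl | refl = adj-sym y z y~z
    independent : ∀ a a′ → a ∈ pair x z → a′ ∈ pair x z → ¬ Adj k a a′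
    independent a a′ a∈xz a′∈xz with pair∈ a∈xz | pair∈ a′∈xz
    ... | inj₁ refl | inj₁ refl = ¬adj-refl x
    ... | inj₁ refl | inj₂ refl = ¬x~z
    ... | inj₂ refl | inj₁ refl = ¬x~z ∘ adj-sym z x
    ... | inj₂ refl | inj₂ refl = ¬adj-refl z

  triple-maximal : ∀ {S : Subset n} {x y z} → Adj k x y → Adj k y z → x ≢ z → IsTriple S x y z →
    ∀ T → S ⊆ T → IsCompleteBipartite k T → T ⊆ S
  triple-maximal {S} {x} {y} {z} x~y y~z x≢z S≐ T S⊆T cb {v} v∈T with bipartition cb
  ... | A , B , P , _ = Equivalence.from (S≐ v) (v∈xyz (sides P x∈T y∈T x~y) (sides P y∈T z∈T y~z))
    where
    open Bipartition P
    x∈T = S⊆T (Equivalence.from (S≐ x) (inj₁ refl))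
    y∈T = S⊆T (Equivalence.from (S≐ y) (inj₂ (inj₁ refl)))
    z∈T = S⊆T (Equivalence.from (S≐ z) (inj₂ (inj₂ refl)))
    v∈xyz : (x ∈ A × y ∈ B) ⊎ (x ∈ B × y ∈ A) → (y ∈ A × z ∈ B) ⊎ (y ∈ B × z ∈ A) →
      v ≡ x ⊎ v ≡ y ⊎ v ≡ z
    v∈xyz (inj₁ (x∈A , y∈B)) (inj₂ (_ , z∈A)) = ⊆triple P x∈A z∈A x≢z y∈B v∈T
    v∈xyz (inj₂ (x∈B , y∈A)) (inj₁ (_ , z∈B)) = ⊆triple (flip P) x∈B z∈B x≢z y∈A v∈T
    v∈xyz (inj₁ (_ , y∈B)) (inj₁ (y∈A , _)) = ⊥-elim (disjoint y∈A y∈B)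
    v∈xyz (inj₂ (_ , y∈A)) (inj₂ (y∈B , _)) = ⊥-elim (disjoint y∈A y∈B)

  P3⇒biclique : ∀ {S : Subset n} → InducesP3 k S → IsBiclique k S
  P3⇒biclique (_ , _ , _ , _ , _ , x≢z , x~y , y~z , ¬x~z , S≐) =
    triple-completeBipartite x~y y~z ¬x~z S≐ , triple-maximal x~y y~z x≢z S≐

  universal-pair-maximal : ∀ {S : Subset n} {x y} → Universal k x → Universal k y → x ≢ y →
    IsPair S x y → ∀ T → S ⊆ T → IsCompleteBipartite k T → T ⊆ S
  universal-pair-maximal {S} {x} {y} x-univ y-univ x≢y S≐ T S⊆T cb {v} v∈T with bipartition cb
  ... | A , B , P , _ = Equivalence.from (S≐ v) (v∈xy (sides P x∈T y∈T (y-univ x x≢y)))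
    where
    open Bipartition P
    x∈T = S⊆T (Equivalence.from (S≐ x) (inj₁ refl))
    y∈T = S⊆T (Equivalence.from (S≐ y) (inj₂ refl))
    v∈xy : (x ∈ A × y ∈ B) ⊎ (x ∈ B × y ∈ A) → v ≡ x ⊎ v ≡ y
    v∈xy (inj₁ (x∈A , y∈B)) =
      map⊎ (universal-alone P x-univ x∈A) (universal-alone (flip P) y-univ y∈B) (split v∈T)
    v∈xy (inj₂ (x∈B , y∈A)) =
      swap (map⊎ (universal-alone P y-univ y∈A) (universal-alone (flip P) x-univ x∈B) (split v∈T))

  universal-pair-biclique : ∀ {x y : Fin n} → Universal k x → Universal k y → x ≢ y →
    IsBiclique k (pair x y) × InducesP2 k (pair x y)
  universal-pair-biclique {x} {y} x-univ y-univ x≢y =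
    ( pair-completeBipartite x~y (pair-isPair x y)
    , universal-pair-maximal x-univ y-univ x≢y (pair-isPair x y)) ,
    x , y , x≢y , x~y , pair-isPair x y
    where x~y = y-univ x x≢y

  -- Otherwise {x, y, z} would be a strictly larger complete bipartite set.
  biclique-pair-undistinguished : ∀ {S : Subset n} {x y z} → IsBiclique k S → IsPair S x y →
    Adj k x y → ¬ Distinguishes k z x y
  biclique-pair-undistinguished {S} {x} {y} {z} (_ , maximal) S≐ x~y (z≢x , ¬z~x , z~y) =
    [ z≢x , adj⇒≢ z y z~y ] (Equivalence.to (S≐ z) z∈S)
    where
    T = triple x y z
    S⊆T : S ⊆ T
    S⊆T {v} v∈S = Equivalence.from (triple-isTriple x y z v)
      ([ inj₁ , inj₂ ∘ inj₁ ] (Equivalence.to (S≐ v) v∈S))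
    z∈S : z ∈ S
    z∈S = maximal T S⊆T
      (triple-completeBipartite x~y (adj-sym z y z~y) (¬z~x ∘ adj-sym x z) (triple-isTriple x y z))
      (Equivalence.from (triple-isTriple x y z z) (inj₂ (inj₂ refl)))

  small-bicliques : n ≤ k + 1 → ∀ (S : Subset n) → IsBiclique k S → InducesP2 k S
  small-bicliques n≤k+1 S (cb , _) with classify cb
  ... | inj₁ p2 = p2
  ... | inj₂ (x , _ , z , _ , _ , x≢z , _ , _ , ¬x~z , _) = ⊥-elim (¬x~z (all-universal z x x≢z))
    where
    n≤1+k = subst (n ≤_) (+-comm k 1) n≤k+1
    all-universal : ∀ u → Universal k u
    all-universal u =
      universal refl (m<1+n⇒m≤n (<-≤-trans (toℕ<n u) n≤1+k)) (≤-trans n≤1+k (s≤s (m≤n+m k (toℕ u))))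

  large-bicliques : 2 * k + 1 ≤ n → ∀ (S : Subset n) → IsBiclique k S → InducesP3 k S
  large-bicliques 2k+1≤n S bc with classify (proj₁ bc)
  ... | inj₂ p3 = p3
  ... | inj₁ (x , y , _ , x~y , S≐) with adjacent-distinguished 2k<n x y x~y
    where 2k<n = subst (_≤ n) (trans (+-comm (2 * k) 1) (cong suc (2*k≡k+k k))) 2k+1≤n
  ... | z , inj₁ d = ⊥-elim (biclique-pair-undistinguished bc S≐ x~y d)
  ... | z , inj₂ d = ⊥-elim (biclique-pair-undistinguished bc (isPair-sym S≐) (adj-sym x y x~y) d)

  P2-biclique-exists : k + 2 ≤ n → n ≤ 2 * k → Σ (Subset n) λ S → IsBiclique k S × InducesP2 k S
  P2-biclique-exists k+2≤n n≤2k = pair u w , universal-pair-biclique u-univ w-univ u≢w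
    where
    k<n = <-trans (n<1+n k) (subst (_≤ n) (+-comm k 2) k+2≤n)
    m = n ∸ suc k
    m+k+1≡n : suc (m + k) ≡ n
    m+k+1≡n = trans (sym (+-suc m k)) (m∸n+n≡m k<n)
    n≤k+k = subst (n ≤_) (2*k≡k+k k) n≤2k
    m<k : m < k
    m<k = +-cancelʳ-≤ k (suc m) k (subst (_≤ k + k) (sym m+k+1≡n) n≤k+k)
    m<n = <-trans m<k k<n
    u = fromℕ< m<n
    w = fromℕ< k<n
    u-univ = universal (toℕ-fromℕ< m<n) (<⇒≤ m<k) (≤-reflexive (sym m+k+1≡n))
    w-univ = universal (toℕ-fromℕ< k<n) ≤-refl (m≤n⇒m≤1+n n≤k+k)
    u≢w : u ≢ w
    u≢w u≡w = <⇒≢ m<k (trans (sym (toℕ-fromℕ< m<n)) (trans (cong toℕ u≡w) (toℕ-fromℕ< k<n)))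

  P3-biclique-exists : 1 ≤ k → k + 2 ≤ n → Σ (Subset n) λ S → IsBiclique k S × InducesP3 k S
  P3-biclique-exists 1≤k k+2≤n = triple x y z , P3⇒biclique p3 , p3
    where
    k+1<n = subst (_≤ n) (+-comm k 2) k+2≤n
    1<n = ≤-trans (s≤s (s≤s z≤n)) k+1<n
    0<n = <-trans z<s 1<n
    x = fromℕ< 0<n
    y = fromℕ< 1<n
    z = fromℕ< k+1<n
    x~y : Adj k x y
    x~y = toℕ-adj (toℕ-fromℕ< 0<n) (toℕ-fromℕ< 1<n) (λ ()) (z≤n , 1≤k)
    y~z : Adj k y z
    y~z = toℕ-adj (toℕ-fromℕ< 1<n) (toℕ-fromℕ< k+1<n) (<⇒≢ (s≤s 1≤k)) (s≤s z≤n , ≤-refl)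
    x≁z : x ≢ z × ¬ Adj k x z
    x≁z = toℕ-far (toℕ-fromℕ< 0<n) (toℕ-fromℕ< k+1<n) (1+n≰n ∘ proj₂)
    p3 : InducesP3 k (triple x y z)
    p3 = x , y , z , adj⇒≢ x y x~y , adj⇒≢ y z y~z , proj₁ x≁z ,
         x~y , y~z , proj₂ x≁z , triple-isTriple x y z

lemma1 : (k n : ℕ) → 1 ≤ k → 1 ≤ n →
    ((n ≤ k + 1 → (S : Subset n) → IsBiclique k S → InducesP2 k S) ×
    (k + 2 ≤ n → n ≤ 2 * k →
    ((S : Subset n) → IsBiclique k S → InducesP2 k S ⊎ InducesP3 k S) ×
    Σ (Subset n) (λ S → IsBiclique k S × InducesP2 k S) ×
    Σ (Subset n) (λ S → IsBiclique k S × InducesP3 k S)) ×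
    (2 * k + 1 ≤ n → (S : Subset n) → IsBiclique k S → InducesP3 k S))
lemma1 k n 1≤k _ =
  small-bicliques ,
  (λ k+2≤n n≤2k →
    (λ S → classify ∘ proj₁) , P2-biclique-exists k+2≤n n≤2k , P3-biclique-exists 1≤k k+2≤n) ,
  large-bicliques
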